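{- Let $H$ be a finite, simple, connected graph whose vertices are colored with the colors $\{1,\dots,|V(H)|\}$, each vertex receiving a distinct color. If a graph $G=(V,E)$ is $\varepsilon$-far from $H$-free, then there is a coloring $\chi:V\to\{1,\dots,|V(H)|\}$ such that $G$ contains a set of at least $\frac{\varepsilon}{|E(H)|\cdot|V(H)|^{|V(H)|}}\cdot|V|$ pairwise edge-disjoint colored copies of $H$.
   Context: $G$ is $\varepsilon$-far from $H$-free if more than $\varepsilon|V|$ edges must be deleted from $G$ to obtain a graph containing no subgraph isomorphic to $H$. Given $\chi$, a colored copy of $H$ in $G$ is a subgraph of $G$ together with an isomorphism from $H$ onto it such that each vertex of $H$ is mapped to a vertex of $G$ of the same color.
   Formalization: The proximity parameter ε, both in the notion of being ε-far from H-free and in the bound on the number of copies, takes only rational values. -}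

module Defs where

open import Data.Nat using (ℕ; _∸_; _^_; _<ᵇ_)
import Data.Nat as ℕ
open import Data.Bool using (Bool; true; false; if_then_else_; _∧_)
open import Data.Fin using (Fin; toℕ)
open import Data.Nat.ListAction using (sum)
open import Data.List using (List; map; length; allFin; cartesianProduct)
open import Data.List.Relation.Unary.AllPairs using (AllPairs)
open import Data.Product using (Σ; ∃; _×_; _,_)
open import Data.Integer using (+_)
open import Data.Rational using (ℚ; _/_; _*_; _<_; _≤_)
open import Relation.Binary.PropositionalEquality using (_≡_)
open import Relation.Nullary using (¬_)
open import Function.Definitions using (Injective)

record Graph (n : ℕ) : Set where
  field
    adj    : Fin n → Fin n → Bool
    sym    : ∀ i j → adj i j ≡ adj j i
    irrefl : ∀ i → adj i i ≡ false
open Graph public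

edgeCount : ∀ {n} → Graph n → ℕ
edgeCount {n} G =
  sum (map (λ { (i , j) → if (toℕ i <ᵇ toℕ j) ∧ adj G i j then 1 else 0 })
           (cartesianProduct (allFin n) (allFin n)))

_⊆ᴳ_ : ∀ {n} → Graph n → Graph n → Set
G' ⊆ᴳ G = ∀ i j → adj G' i j ≡ true → adj G i j ≡ true

ContainsCopy : ∀ {k n} → Graph k → Graph n → Set
ContainsCopy {k} {n} H G =
  Σ (Fin k → Fin n) λ f →
    Injective _≡_ _≡_ f × (∀ u v → adj H u v ≡ true → adj G (f u) (f v) ≡ true)

data Reach {k} (H : Graph k) : Fin k → Fin k → Set where
  here : ∀ {u} → Reach H u u
  step : ∀ {u v w} → adj H u v ≡ true → Reach H v w → Reach H u w

Connected : ∀ {k} → Graph k → Set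
Connected {k} H = ∀ (u v : Fin k) → Reach H u v

ℕ→ℚ : ℕ → ℚ
ℕ→ℚ m = (+ m) / 1

FarFrom : ∀ {k n} → ℚ → Graph k → Graph n → Set
FarFrom {k} {n} ε H G =
  ∀ (G' : Graph n) → G' ⊆ᴳ G → ¬ ContainsCopy H G' →
    ε * ℕ→ℚ n < ℕ→ℚ (edgeCount G ∸ edgeCount G')

record ColoredCopy {k n} (H : Graph k) (G : Graph n) (χ : Fin n → Fin k) : Set where
  field
    emb     : Fin k → Fin n
    inj     : Injective _≡_ _≡_ emb
    hom     : ∀ u v → adj H u v ≡ true → adj G (emb u) (emb v) ≡ true
    colored : ∀ u → χ (emb u) ≡ u
open ColoredCopy public

EdgeDisjoint : ∀ {k n} {H : Graph k} {G : Graph n} {χ : Fin n → Fin k} →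
  ColoredCopy H G χ → ColoredCopy H G χ → Set
EdgeDisjoint {k} {H = H} c d =
  ∀ (u v u' v' : Fin k) → adj H u v ≡ true → adj H u' v' ≡ true →
    ¬ (emb c u ≡ emb d u' × emb c v ≡ emb d v')

module Submission where

-- Delete the edges of copies of H from G greedily until no copy is left. The deleted copies are
-- pairwise edge-disjoint and each deletion removes at most |E(H)| edges, so ε-farness leaves more
-- than ε|V|/|E(H)| of them. A uniformly random coloring colors a fixed copy correctly with
-- probability |V(H)|^-|V(H)|, hence some coloring, found by the method of conditional expectations,
-- colors at least a |V(H)|^-|V(H)| fraction of them correctly.

open import Defs hiding (sym)
open import Data.Bool using (Bool; true; false; if_then_else_; _∧_; T)
import Data.Bool.Properties as Bool
open import Data.Fin using (Fin; zero; suc; toℕ; finToFun; funToFin)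
open import Data.Fin.Properties using (_≟_; any?; all?; toℕ-injective; finToFun-funToFin)
import Data.Integer as ℤ
import Data.Integer.Properties as ℤ
open import Data.List using (List; []; _∷_; _++_; map; tabulate; allFin; cartesianProduct; length; lookup)
open import Data.List.Properties using (map-++; map-∘)
open import Data.List.Relation.Unary.All using (All; []; _∷_)
import Data.List.Relation.Unary.All as All
open import Data.List.Relation.Unary.AllPairs using (AllPairs; []; _∷_)
open import Data.Maybe using (Maybe; just; nothing; is-just)
import Data.Maybe as Maybe
open import Data.Nat using (ℕ; zero; suc; _+_; _*_; _^_; _∸_; _≤_; _<_; z≤n; s≤s; s≤s⁻¹; _≤?_; _<ᵇ_; _≡ᵇ_; NonZero)
open import Data.Nat.Coprimality using (1-coprimeTo)
import Data.Nat.Coprimality as Coprimality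
import Data.Nat.ListAction as List
open import Data.Nat.ListAction.Properties using (sum-++)
open import Data.Nat.Properties hiding (_≟_)
open import Algebra.Properties.Semiring.Sum +-*-semiring
  using (sum-syntax; ∑-comm; ∑-distrib-+; *-distribˡ-sum; *-distribʳ-sum; sum-cong-≗)
open import Data.Nat.Tactic.RingSolver using (solve-∀)
open import Data.Product using (Σ; ∃; _×_; _,_; proj₁; proj₂)
open import Data.Rational using (ℚ; mkℚ)
import Data.Rational as ℚ
import Data.Rational.Properties as ℚ
open import Data.Unit using (tt)
import Data.Vec.Functional as Vector
open import Function using (_∘_)
open import Function.Definitions using (Injective)
open import Relation.Binary.PropositionalEquality
open import Relation.Nullary using (Dec; yes; no; does; ¬_)
open import Relation.Nullary.Decidable using (map′; _×-dec_; _→-dec_; dec-true; dec⇒maybe)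
open import Relation.Nullary.Negation using (contradiction)

⟦_⟧ : Bool → ℕ
⟦ b ⟧ = if b then 1 else 0

⟦∧⟧ : ∀ a b → ⟦ a ∧ b ⟧ ≡ ⟦ a ⟧ * ⟦ b ⟧
⟦∧⟧ false b = refl
⟦∧⟧ true  b = sym (+-identityʳ ⟦ b ⟧)

δ : ∀ {n} → Fin n → Fin n → ℕ
δ i j = ⟦ does (i ≟ j) ⟧

δ-diag : ∀ {n} (i : Fin n) → δ i i ≡ 1
δ-diag i = cong ⟦_⟧ (dec-true (i ≟ i) refl)

∑-mono-≤ : ∀ {n} {f g : Fin n → ℕ} → (∀ i → f i ≤ g i) → ∑[ i < n ] f i ≤ ∑[ i < n ] g i
∑-mono-≤ {zero}  f≤g = z≤n
∑-mono-≤ {suc n} f≤g = +-mono-≤ (f≤g zero) (∑-mono-≤ (f≤g ∘ suc))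

∑-mono-< : ∀ {n} {f g : Fin n → ℕ} → (∀ i → f i ≤ g i) → ∀ a → f a < g a →
           ∑[ i < n ] f i < ∑[ i < n ] g i
∑-mono-< f≤g zero    fa<ga = +-mono-<-≤ fa<ga (∑-mono-≤ (f≤g ∘ suc))
∑-mono-< f≤g (suc a) fa<ga = +-mono-≤-< (f≤g zero) (∑-mono-< (f≤g ∘ suc) a fa<ga)

term≤∑ : ∀ {n} (f : Fin n → ℕ) a → f a ≤ ∑[ i < n ] f i
term≤∑ f zero    = m≤m+n (f zero) _
term≤∑ f (suc a) = ≤-trans (term≤∑ (f ∘ suc) a) (m≤n+m _ (f zero))

∑>0⇒term>0 : ∀ {n} (f : Fin n → ℕ) → 0 < ∑[ i < n ] f i → ∃ λ a → 0 < f a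
∑>0⇒term>0 {suc n} f 0<∑ with f zero in f0
... | suc _ = zero , subst (0 <_) (sym f0) (s≤s z≤n)
... | zero with ∑>0⇒term>0 (f ∘ suc) 0<∑
...   | a , 0<fa = suc a , 0<fa

∑-const : ∀ n c → ∑[ i < n ] c ≡ n * c
∑-const zero    c = refl
∑-const (suc n) c = cong (c +_) (∑-const n c)

∑-δ : ∀ {n} a (f : Fin n → ℕ) → ∑[ i < n ] (δ a i * f i) ≡ f a
∑-δ {suc n} zero    f = trans (cong₂ _+_ (+-identityʳ (f zero)) (trans (∑-const n 0) (*-zeroʳ n)))
                              (+-identityʳ (f zero))
∑-δ {suc n} (suc a) f = ∑-δ a (f ∘ suc)

∑∑-comm-∑∑ : ∀ {a b c d} (X : Fin a → Fin b → Fin c → Fin d → ℕ) →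
  ∑[ i < a ] ∑[ j < b ] ∑[ u < c ] ∑[ v < d ] X i j u v ≡
  ∑[ u < c ] ∑[ v < d ] ∑[ i < a ] ∑[ j < b ] X i j u v
∑∑-comm-∑∑ X = begin
  ∑[ i < _ ] ∑[ j < _ ] ∑[ u < _ ] ∑[ v < _ ] X i j u v
    ≡⟨ sum-cong-≗ (λ i → ∑-comm (λ j u → ∑[ v < _ ] X i j u v)) ⟩
  ∑[ i < _ ] ∑[ u < _ ] ∑[ j < _ ] ∑[ v < _ ] X i j u v
    ≡⟨ ∑-comm (λ i u → ∑[ j < _ ] ∑[ v < _ ] X i j u v) ⟩
  ∑[ u < _ ] ∑[ i < _ ] ∑[ j < _ ] ∑[ v < _ ] X i j u v
    ≡⟨ sum-cong-≗ (λ u → sum-cong-≗ (λ i → ∑-comm (λ j v → X i j u v))) ⟩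
  ∑[ u < _ ] ∑[ i < _ ] ∑[ v < _ ] ∑[ j < _ ] X i j u v
    ≡⟨ sum-cong-≗ (λ u → ∑-comm (λ i v → ∑[ j < _ ] X i j u v)) ⟩
  ∑[ u < _ ] ∑[ v < _ ] ∑[ i < _ ] ∑[ j < _ ] X i j u v
    ∎
  where open ≡-Reasoning

pigeonhole : ∀ {m} (S : Fin (suc m) → ℕ) T → suc m * T ≤ ∑[ c < suc m ] S c → ∃ λ c → T ≤ S c
pigeonhole {m} S T mT≤∑S with any? (λ c → T ≤? S c)
... | yes found = found
... | no ∄found = contradiction mT≤∑S (<⇒≱ (begin-strict
  ∑[ c < suc m ] S c <⟨ ∑-mono-< (<⇒≤ ∘ S<T) zero (S<T zero) ⟩
  ∑[ c < suc m ] T   ≡⟨ ∑-const (suc m) T ⟩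
  suc m * T          ∎))
  where
  open ≤-Reasoning
  S<T : ∀ c → S c < T
  S<T c = ≰⇒> (λ T≤Sc → ∄found (c , T≤Sc))

sum-map-tabulate : ∀ {A : Set} {m} (g : A → ℕ) (f : Fin m → A) →
                   List.sum (map g (tabulate f)) ≡ ∑[ i < m ] g (f i)
sum-map-tabulate {m = zero}  g f = refl
sum-map-tabulate {m = suc m} g f = cong (g (f zero) +_) (sum-map-tabulate g (f ∘ suc))

sum-map-cartesianProduct : ∀ {A B : Set} {m} (g : A × B → ℕ) (f : Fin m → A) (ys : List B) →
  List.sum (map g (cartesianProduct (tabulate f) ys)) ≡ ∑[ i < m ] List.sum (map (λ y → g (f i , y)) ys)
sum-map-cartesianProduct {m = zero}  g f ys = refl
sum-map-cartesianProduct {m = suc m} g f ys = begin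
  List.sum (map g (map (f zero ,_) ys ++ rest))
    ≡⟨ cong List.sum (map-++ g (map (f zero ,_) ys) rest) ⟩
  List.sum (map g (map (f zero ,_) ys) ++ map g rest)
    ≡⟨ sum-++ (map g (map (f zero ,_) ys)) (map g rest) ⟩
  List.sum (map g (map (f zero ,_) ys)) + List.sum (map g rest)
    ≡⟨ cong₂ _+_ (cong List.sum (sym (map-∘ ys))) (sum-map-cartesianProduct g (f ∘ suc) ys) ⟩
  List.sum (map (λ y → g (f zero , y)) ys) + ∑[ i < m ] List.sum (map (λ y → g (f (suc i) , y)) ys)
    ∎
  where
  open ≡-Reasoning
  rest = cartesianProduct (tabulate (f ∘ suc)) ys

edgeCount≡∑ : ∀ {n} (G : Graph n) →
  edgeCount G ≡ ∑[ i < n ] ∑[ j < n ] ⟦ (toℕ i <ᵇ toℕ j) ∧ adj G i j ⟧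
edgeCount≡∑ {n} G = trans (sum-map-cartesianProduct {m = n} _ (λ i → i) (allFin n))
  (sum-cong-≗ (λ i → sum-map-tabulate (λ j → ⟦ (toℕ i <ᵇ toℕ j) ∧ adj G i j ⟧) (λ j → j)))

-- Counting arcs (ordered adjacent pairs) instead of edges spares us orienting the edges of a copy.
arcCount : ∀ {n} → Graph n → ℕ
arcCount {n} G = ∑[ i < n ] ∑[ j < n ] ⟦ adj G i j ⟧

arc-mono : ∀ {n} {G′ G : Graph n} → G′ ⊆ᴳ G → ∀ i j → ⟦ adj G′ i j ⟧ ≤ ⟦ adj G i j ⟧
arc-mono {G′ = G′} G′⊆G i j with adj G′ i j in ij
... | false = z≤n
... | true  rewrite G′⊆G i j ij = ≤-refl

<ᵇ≡false⇒≮ : ∀ {m n} → (m <ᵇ n) ≡ false → ¬ m < n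
<ᵇ≡false⇒≮ m<ᵇn≡false m<n = subst T m<ᵇn≡false (<⇒<ᵇ m<n)

arc≡forward+backward : ∀ {n} (G : Graph n) i j →
  ⟦ adj G i j ⟧ ≡ ⟦ (toℕ i <ᵇ toℕ j) ∧ adj G i j ⟧ + ⟦ (toℕ j <ᵇ toℕ i) ∧ adj G j i ⟧
arc≡forward+backward G i j with toℕ i <ᵇ toℕ j in i<j | toℕ j <ᵇ toℕ i in j<i
... | true  | true  = contradiction (<ᵇ⇒< (toℕ i) (toℕ j) (subst T (sym i<j) tt))
                        (<-asym (<ᵇ⇒< (toℕ j) (toℕ i) (subst T (sym j<i) tt)))
... | true  | false = sym (+-identityʳ _)
... | false | true  = cong ⟦_⟧ (Graph.sym G i j)
... | false | false = cong ⟦_⟧ (trans (cong (adj G i) (sym i≡j)) (irrefl G i))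
  where
  i≡j : i ≡ j
  i≡j = toℕ-injective (≤-antisym (≮⇒≥ (<ᵇ≡false⇒≮ j<i)) (≮⇒≥ (<ᵇ≡false⇒≮ i<j)))

arcCount≡2*edgeCount : ∀ {n} (G : Graph n) → arcCount G ≡ 2 * edgeCount G
arcCount≡2*edgeCount {n} G = begin
  arcCount G
    ≡⟨ sum-cong-≗ (λ i → sum-cong-≗ (arc≡forward+backward G i)) ⟩
  ∑[ i < n ] ∑[ j < n ] (forward i j + forward j i)
    ≡⟨ sum-cong-≗ (λ i → ∑-distrib-+ (forward i) (λ j → forward j i)) ⟩
  ∑[ i < n ] (∑[ j < n ] forward i j + ∑[ j < n ] forward j i)
    ≡⟨ ∑-distrib-+ (λ i → ∑[ j < n ] forward i j) (λ i → ∑[ j < n ] forward j i) ⟩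
  ∑[ i < n ] ∑[ j < n ] forward i j + ∑[ i < n ] ∑[ j < n ] forward j i
    ≡⟨ cong (∑[ i < n ] ∑[ j < n ] forward i j +_) (∑-comm (λ i j → forward j i)) ⟩
  ∑[ i < n ] ∑[ j < n ] forward i j + ∑[ i < n ] ∑[ j < n ] forward i j
    ≡⟨ cong₂ _+_ (sym (edgeCount≡∑ G)) (sym (edgeCount≡∑ G)) ⟩
  edgeCount G + edgeCount G
    ≡⟨ cong (edgeCount G +_) (sym (+-identityʳ _)) ⟩
  2 * edgeCount G
    ∎
  where
  open ≡-Reasoning
  forward : Fin n → Fin n → ℕ
  forward i j = ⟦ (toℕ i <ᵇ toℕ j) ∧ adj G i j ⟧

1≤edgeCount⇒edge : ∀ {k} (H : Graph k) → 1 ≤ edgeCount H → ∃ λ u → ∃ λ v → adj H u v ≡ true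
1≤edgeCount⇒edge {k} H 1≤e
  with ∑>0⇒term>0 (λ u → ∑[ v < k ] ⟦ adj H u v ⟧)
         (≤-trans 1≤e (≤-trans (m≤m+n _ _) (≤-reflexive (sym (arcCount≡2*edgeCount H)))))
... | u , 0<∑ with ∑>0⇒term>0 (λ v → ⟦ adj H u v ⟧) 0<∑
...   | v , 0<uv with adj H u v in uv
...     | true = u , v , uv

edgeCount-∸-≤ : ∀ {n k} (G G′ : Graph n) (H : Graph k) m →
  arcCount G ≤ arcCount G′ + m * arcCount H → edgeCount G ∸ edgeCount G′ ≤ m * edgeCount H
edgeCount-∸-≤ G G′ H m bound = m≤n+o⇒m∸n≤o (edgeCount G) (edgeCount G′) (*-cancelˡ-≤ 2 (begin
  2 * edgeCount G                           ≡⟨ arcCount≡2*edgeCount G ⟨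
  arcCount G                                ≤⟨ bound ⟩
  arcCount G′ + m * arcCount H              ≡⟨ cong₂ (λ a b → a + m * b) (arcCount≡2*edgeCount G′)
                                                                       (arcCount≡2*edgeCount H) ⟩
  2 * edgeCount G′ + m * (2 * edgeCount H)  ≡⟨ factor-2 (edgeCount G′) m (edgeCount H) ⟩
  2 * (edgeCount G′ + m * edgeCount H)      ∎))
  where
  open ≤-Reasoning
  factor-2 : ∀ a m b → 2 * a + m * (2 * b) ≡ 2 * (a + m * b)
  factor-2 = solve-∀

Homomorphism : ∀ {k n} → Graph k → Graph n → (Fin k → Fin n) → Set
Homomorphism H G f = ∀ u v → adj H u v ≡ true → adj G (f u) (f v) ≡ true

IsCopy : ∀ {k n} → Graph k → Graph n → (Fin k → Fin n) → Set
IsCopy H G f = Injective _≡_ _≡_ f × Homomorphism H G f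

isCopy? : ∀ {k n} (H : Graph k) (G : Graph n) f → Dec (IsCopy H G f)
isCopy? H G f = injective? ×-dec homomorphism?
  where
  injective? = map′ (λ inj {x} {y} → inj x y) (λ inj x y → inj {x} {y})
                    (all? λ x → all? λ y → f x ≟ f y →-dec x ≟ y)
  homomorphism? = all? λ u → all? λ v → adj H u v Bool.≟ true →-dec adj G (f u) (f v) Bool.≟ true

isCopy-resp-≗ : ∀ {k n} {H : Graph k} {G : Graph n} {f g} → f ≗ g → IsCopy H G f → IsCopy H G g
isCopy-resp-≗ {G = G} {f} {g} f≗g (inj , hom) =
  (λ {x} {y} gx≡gy → inj (trans (f≗g x) (trans gx≡gy (sym (f≗g y))))) ,
  (λ u v uv → subst₂ (λ x y → adj G x y ≡ true) (f≗g u) (f≗g v) (hom u v uv))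

containsCopy? : ∀ {k n} (H : Graph k) (G : Graph n) → Dec (ContainsCopy H G)
containsCopy? H G = map′
  (λ (i , copy) → finToFun i , copy)
  (λ (f , copy) → funToFin f , isCopy-resp-≗ {H = H} {G} (sym ∘ finToFun-funToFin f) copy)
  (any? λ i → isCopy? H G (finToFun i))

module _ {k n : ℕ} (H : Graph k) where

  multiplicity : (Fin k → Fin n) → Fin n → Fin n → ℕ
  multiplicity f i j = ∑[ u < k ] ∑[ v < k ] (δ (f u) i * (δ (f v) j * ⟦ adj H u v ⟧))

  multiplicity-sym : ∀ f i j → multiplicity f i j ≡ multiplicity f j i
  multiplicity-sym f i j =
    trans (∑-comm (λ u v → δ (f u) i * (δ (f v) j * ⟦ adj H u v ⟧))) (sum-cong-≗ λ v → sum-cong-≗ λ u → begin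
      δ (f u) i * (δ (f v) j * ⟦ adj H u v ⟧) ≡⟨ sym (*-assoc (δ (f u) i) _ _) ⟩
      δ (f u) i * δ (f v) j * ⟦ adj H u v ⟧   ≡⟨ cong₂ _*_ (*-comm (δ (f u) i) _) (cong ⟦_⟧ (Graph.sym H u v)) ⟩
      δ (f v) j * δ (f u) i * ⟦ adj H v u ⟧   ≡⟨ *-assoc (δ (f v) j) _ _ ⟩
      δ (f v) j * (δ (f u) i * ⟦ adj H v u ⟧) ∎)
    where open ≡-Reasoning

  ∑∑-multiplicity : ∀ f → ∑[ i < n ] ∑[ j < n ] multiplicity f i j ≡ arcCount H
  ∑∑-multiplicity f =
    trans (∑∑-comm-∑∑ (λ i j u v → δ (f u) i * (δ (f v) j * ⟦ adj H u v ⟧))) (sum-cong-≗ λ u → sum-cong-≗ λ v → begin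
      ∑[ i < n ] ∑[ j < n ] (δ (f u) i * (δ (f v) j * ⟦ adj H u v ⟧))
        ≡⟨ sum-cong-≗ (λ i → sym (*-distribˡ-sum (δ (f u) i) (λ j → δ (f v) j * ⟦ adj H u v ⟧))) ⟩
      ∑[ i < n ] (δ (f u) i * ∑[ j < n ] (δ (f v) j * ⟦ adj H u v ⟧))
        ≡⟨ ∑-δ (f u) _ ⟩
      ∑[ j < n ] (δ (f v) j * ⟦ adj H u v ⟧)
        ≡⟨ ∑-δ (f v) _ ⟩
      ⟦ adj H u v ⟧ ∎)
    where open ≡-Reasoning

  multiplicity-image : ∀ f {u v} → adj H u v ≡ true → 0 < multiplicity f (f u) (f v)
  multiplicity-image f {u} {v} uv = ≤-trans 1≤term
    (≤-trans (term≤∑ (λ v′ → δ (f u) (f u) * (δ (f v′) (f v) * ⟦ adj H u v′ ⟧)) v)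
             (term≤∑ (λ u′ → ∑[ v′ < k ] (δ (f u′) (f u) * (δ (f v′) (f v) * ⟦ adj H u′ v′ ⟧))) u))
    where
    1≤term : 1 ≤ δ (f u) (f u) * (δ (f v) (f v) * ⟦ adj H u v ⟧)
    1≤term rewrite δ-diag (f u) | δ-diag (f v) | uv = s≤s z≤n

  deleteImage : Graph n → (Fin k → Fin n) → Graph n
  deleteImage G f = record
    { adj    = λ i j → adj G i j ∧ (multiplicity f i j ≡ᵇ 0)
    ; sym    = λ i j → cong₂ _∧_ (Graph.sym G i j) (cong (_≡ᵇ 0) (multiplicity-sym f i j))
    ; irrefl = λ i → cong (_∧ _) (irrefl G i)
    }

  deleteImage-⊆ : ∀ G f → deleteImage G f ⊆ᴳ G
  deleteImage-⊆ G f i j ij with adj G i j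
  ... | true = refl

  deleteImage-removes : ∀ G f u v → adj H u v ≡ true → adj (deleteImage G f) (f u) (f v) ≡ false
  deleteImage-removes G f u v uv with multiplicity f (f u) (f v) | multiplicity-image f uv
  ... | suc _ | _ = Bool.∧-zeroʳ (adj G (f u) (f v))

  arc≤arc-deleteImage+multiplicity : ∀ G f i j →
    ⟦ adj G i j ⟧ ≤ ⟦ adj (deleteImage G f) i j ⟧ + multiplicity f i j
  arc≤arc-deleteImage+multiplicity G f i j with adj G i j | multiplicity f i j
  ... | false | _     = z≤n
  ... | true  | zero  = ≤-refl
  ... | true  | suc m = s≤s z≤n

  arcCount-deleteImage : ∀ G f → arcCount G ≤ arcCount (deleteImage G f) + arcCount H
  arcCount-deleteImage G f = begin
    arcCount G
      ≤⟨ ∑-mono-≤ (λ i → ∑-mono-≤ (arc≤arc-deleteImage+multiplicity G f i)) ⟩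
    ∑[ i < n ] ∑[ j < n ] (⟦ adj G′ i j ⟧ + multiplicity f i j)
      ≡⟨ sum-cong-≗ (λ i → ∑-distrib-+ (λ j → ⟦ adj G′ i j ⟧) (multiplicity f i)) ⟩
    ∑[ i < n ] (∑[ j < n ] ⟦ adj G′ i j ⟧ + ∑[ j < n ] multiplicity f i j)
      ≡⟨ ∑-distrib-+ (λ i → ∑[ j < n ] ⟦ adj G′ i j ⟧) (λ i → ∑[ j < n ] multiplicity f i j) ⟩
    arcCount G′ + ∑[ i < n ] ∑[ j < n ] multiplicity f i j
      ≡⟨ cong (arcCount G′ +_) (∑∑-multiplicity f) ⟩
    arcCount G′ + arcCount H ∎
    where
    open ≤-Reasoning
    G′ = deleteImage G f

  arcCount-deleteImage-< : ∀ G f {u v} → Homomorphism H G f → adj H u v ≡ true →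
                           arcCount (deleteImage G f) < arcCount G
  arcCount-deleteImage-< G f {u} {v} hom uv =
    ∑-mono-< (λ i → ∑-mono-≤ (arc-mono {G′ = G′} {G} (deleteImage-⊆ G f) i)) (f u)
      (∑-mono-< (arc-mono {G′ = G′} {G} (deleteImage-⊆ G f) (f u)) (f v)
        (subst₂ (λ a b → ⟦ a ⟧ < ⟦ b ⟧) (sym (deleteImage-removes G f u v uv)) (sym (hom u v uv)) ≤-refl))
    where G′ = deleteImage G f

NoCommonEdge : ∀ {k n} → Graph k → (Fin k → Fin n) → (Fin k → Fin n) → Set
NoCommonEdge H f g = ∀ u v u′ v′ → adj H u v ≡ true → adj H u′ v′ ≡ true → ¬ (f u ≡ g u′ × f v ≡ g v′)

module _ {k n : ℕ} (H : Graph k) (G : Graph n) where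

  EdgeDisjointCopies : ContainsCopy H G → ContainsCopy H G → Set
  EdgeDisjointCopies (f , _) (g , _) = NoCommonEdge H f g

  EdgesAbsentFrom : Graph n → ContainsCopy H G → Set
  EdgesAbsentFrom G′ (f , _) = ∀ u v → adj H u v ≡ true → adj G′ (f u) (f v) ≡ false

  edgesAbsent-⊆ : ∀ {G″ G′} → G″ ⊆ᴳ G′ → ∀ {c} → EdgesAbsentFrom G′ c → EdgesAbsentFrom G″ c
  edgesAbsent-⊆ {G″} G″⊆G′ {f , _} absent u v uv with adj G″ (f u) (f v) in e
  ... | false = refl
  ... | true  = contradiction (trans (sym (G″⊆G′ _ _ e)) (absent u v uv)) λ ()

  record Packing (G′ : Graph n) : Set where
    field
      G′⊆G     : G′ ⊆ᴳ G
      copies   : List (ContainsCopy H G)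
      disjoint : AllPairs EdgeDisjointCopies copies
      absent   : All (EdgesAbsentFrom G′) copies
      arcs     : arcCount G ≤ arcCount G′ + length copies * arcCount H

  emptyPacking : Packing G
  emptyPacking = record
    { G′⊆G = λ _ _ ij → ij ; copies = [] ; disjoint = [] ; absent = []
    ; arcs = ≤-reflexive (sym (+-identityʳ (arcCount G))) }

  packing-deleteImage : ∀ {G′} → Packing G′ → ∀ f → IsCopy H G′ f → Packing (deleteImage H G′ f)
  packing-deleteImage {G′} P f (inj , hom) = record
    { G′⊆G     = λ i j ij → G′⊆G i j (deleteImage-⊆ H G′ f i j ij)
    ; copies   = c ∷ copies
    ; disjoint = All.map (λ {d} → disjoint-from-c {d}) absent ∷ disjoint
    ; absent   = deleteImage-removes H G′ f
                 ∷ All.map (λ {d} → edgesAbsent-⊆ {G″} {G′} (deleteImage-⊆ H G′ f) {d}) absent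
    ; arcs     = begin
        arcCount G                                             ≤⟨ arcs ⟩
        arcCount G′ + length copies * arcCount H               ≤⟨ +-monoˡ-≤ _ (arcCount-deleteImage H G′ f) ⟩
        arcCount G″ + arcCount H + length copies * arcCount H  ≡⟨ +-assoc (arcCount G″) _ _ ⟩
        arcCount G″ + length (c ∷ copies) * arcCount H         ∎
    }
    where
    open Packing P
    open ≤-Reasoning
    G″ = deleteImage H G′ f
    c : ContainsCopy H G
    c = f , inj , λ u v uv → G′⊆G _ _ (hom u v uv)
    disjoint-from-c : ∀ {d} → EdgesAbsentFrom G′ d → EdgeDisjointCopies c d
    disjoint-from-c absent-d u v u′ v′ uv u′v′ (fu≡gu′ , fv≡gv′) =
      contradiction (trans (sym (hom u v uv)) (subst₂ (λ x y → adj G′ x y ≡ false)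
                      (sym fu≡gu′) (sym fv≡gv′) (absent-d u′ v′ u′v′))) λ ()

  greedyPacking : ∀ {u v} → adj H u v ≡ true → ∃ λ G′ → Packing G′ × ¬ ContainsCopy H G′
  greedyPacking uv = go (suc (arcCount G)) ≤-refl emptyPacking
    where
    go : ∀ fuel {G′} → arcCount G′ < fuel → Packing G′ → ∃ λ G′ → Packing G′ × ¬ ContainsCopy H G′
    go (suc fuel) {G′} G′<fuel P with containsCopy? H G′
    ... | no free                  = G′ , P , free
    ... | yes (f , copy@(_ , hom)) =
      go fuel (<-≤-trans (arcCount-deleteImage-< H G′ f hom uv) (s≤s⁻¹ G′<fuel)) (packing-deleteImage P f copy)

PartialColoring : ℕ → ℕ → Set
PartialColoring n k = Fin n → Maybe (Fin k)

fits : ∀ {k} → Fin k → Maybe (Fin k) → Bool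
fits c nothing   = true
fits c (just c′) = does (c′ ≟ c)

extends : ∀ {n k} → (Fin n → Fin k) → PartialColoring n k → Bool
extends {zero}  χ d = true
extends {suc n} χ d = fits (χ zero) (d zero) ∧ extends (χ ∘ suc) (d ∘ suc)

extends⇒agrees : ∀ {n k} (χ : Fin n → Fin k) d → extends χ d ≡ true → ∀ {x c} → d x ≡ just c → χ x ≡ c
extends⇒agrees {suc n} χ d ext {zero} {c} d0≡c rewrite d0≡c with c ≟ χ zero
... | yes c≡χ0 = sym c≡χ0
... | no _     = contradiction ext λ ()
extends⇒agrees {suc n} χ d ext {suc x} dx≡c with fits (χ zero) (d zero)
... | true = extends⇒agrees (χ ∘ suc) (d ∘ suc) ext dx≡c

size : ∀ {n k} → PartialColoring n k → ℕ
size {n} d = ∑[ x < n ] ⟦ is-just (d x) ⟧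

weight : ∀ {n k} → PartialColoring n k → ℕ
weight {k = k} d = k ^ size d

∑-fits : ∀ {k} (m : Maybe (Fin k)) → ∑[ c < k ] (⟦ fits c m ⟧ * k ^ ⟦ is-just m ⟧) ≡ k
∑-fits {k} nothing   = trans (∑-const k 1) (*-identityʳ k)
∑-fits {k} (just c′) = trans (∑-δ c′ (λ _ → k ^ 1)) (*-identityʳ k)

weightGiven : ∀ {n k m} → Fin k → (Fin m → PartialColoring (suc n) k) → (Fin m → ℕ) → Fin m → ℕ
weightGiven {k = k} c d w a = ⟦ fits c (d a zero) ⟧ * k ^ ⟦ is-just (d a zero) ⟧ * w a

∑-weightGiven : ∀ {n k m} (d : Fin m → PartialColoring (suc n) k) (w : Fin m → ℕ) →
  ∑[ c < k ] ∑[ a < m ] weightGiven c d w a ≡ k * ∑[ a < m ] w a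
∑-weightGiven {k = k} {m} d w = begin
  ∑[ c < k ] ∑[ a < m ] weightGiven c d w a
    ≡⟨ ∑-comm (λ c a → weightGiven c d w a) ⟩
  ∑[ a < m ] ∑[ c < k ] (fits-weight a c * w a)
    ≡⟨ sum-cong-≗ (λ a → sym (*-distribʳ-sum (w a) (fits-weight a))) ⟩
  ∑[ a < m ] (∑[ c < k ] fits-weight a c * w a)
    ≡⟨ sum-cong-≗ (λ a → cong (_* w a) (∑-fits (d a zero))) ⟩
  ∑[ a < m ] (k * w a)
    ≡⟨ *-distribˡ-sum k w ⟨
  k * ∑[ a < m ] w a ∎
  where
  open ≡-Reasoning
  fits-weight : Fin m → Fin k → ℕ
  fits-weight a c = ⟦ fits c (d a zero) ⟧ * k ^ ⟦ is-just (d a zero) ⟧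

weightGiven-∷ : ∀ {n k m} c (χ : Fin n → Fin k) (d : Fin m → PartialColoring (suc n) k) w a →
  ⟦ extends χ (d a ∘ suc) ⟧ * (weight (d a ∘ suc) * weightGiven c d w a)
    ≡ ⟦ extends (c Vector.∷ χ) (d a) ⟧ * (weight (d a) * w a)
weightGiven-∷ {k = k} c χ d w a = begin
  E * (W′ * (F * V * w a))                         ≡⟨ rearrange E W′ F V (w a) ⟩
  F * E * (V * W′ * w a)                           ≡⟨ cong₂ (λ x y → x * (y * w a))
                                                       (sym (⟦∧⟧ (fits c (d a zero)) _))
                                                       (sym (^-distribˡ-+-* k ⟦ is-just (d a zero) ⟧ (size (d a ∘ suc)))) ⟩
  ⟦ extends (c Vector.∷ χ) (d a) ⟧ * (weight (d a) * w a) ∎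
  where
  open ≡-Reasoning
  E = ⟦ extends χ (d a ∘ suc) ⟧
  W′ = weight (d a ∘ suc)
  F = ⟦ fits c (d a zero) ⟧
  V = k ^ ⟦ is-just (d a zero) ⟧
  rearrange : ∀ e w f v x → e * (w * (f * v * x)) ≡ f * e * (v * w * x)
  rearrange = solve-∀

-- For uniformly random χ, χ extends d with probability k ^ -(size d), so the right-hand side has
-- mean ∑ w. Giving vertex zero a best color (pigeonhole) and recursing does not lower it.
conditionalExpectation : ∀ {n k m} (d : Fin m → PartialColoring n (suc k)) (w : Fin m → ℕ) →
  ∃ λ χ → ∑[ a < m ] w a ≤ ∑[ a < m ] (⟦ extends χ (d a) ⟧ * (weight (d a) * w a))
conditionalExpectation {zero} d w =
  (λ ()) , ≤-reflexive (sum-cong-≗ λ a → sym (trans (*-identityˡ _) (*-identityˡ (w a))))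
conditionalExpectation {suc n} {k} {m} d w
  with pigeonhole (λ c → ∑[ a < m ] weightGiven c d w a) (∑[ a < m ] w a) (≤-reflexive (sym (∑-weightGiven d w)))
... | c , ∑w≤ with conditionalExpectation (λ a → d a ∘ suc) (weightGiven c d w)
...   | χ , ≤∑ = c Vector.∷ χ , ≤-trans ∑w≤ (≤-trans ≤∑ (≤-reflexive (sum-cong-≗ (weightGiven-∷ c χ d w))))

preimage : ∀ {k n} → (Fin k → Fin n) → PartialColoring n k
preimage f x = Maybe.map proj₁ (dec⇒maybe (any? λ u → f u ≟ x))

preimage-image : ∀ {k n} {f : Fin k → Fin n} → Injective _≡_ _≡_ f → ∀ u → preimage f (f u) ≡ just u
preimage-image {f = f} inj u with any? (λ u′ → f u′ ≟ f u)
... | yes (u′ , fu′≡fu) = cong just (inj fu′≡fu)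
... | no ∄u′            = contradiction (u , refl) ∄u′

size-preimage : ∀ {k n} (f : Fin k → Fin n) → size (preimage f) ≤ k
size-preimage {k} {n} f = begin
  ∑[ x < n ] ⟦ is-just (preimage f x) ⟧  ≤⟨ ∑-mono-≤ defined≤hits ⟩
  ∑[ x < n ] ∑[ u < k ] δ (f u) x       ≡⟨ ∑-comm (λ x u → δ (f u) x) ⟩
  ∑[ u < k ] ∑[ x < n ] δ (f u) x       ≡⟨ sum-cong-≗ (λ u → hits (f u)) ⟩
  ∑[ u < k ] 1                          ≡⟨ trans (∑-const k 1) (*-identityʳ k) ⟩
  k                                     ∎
  where
  open ≤-Reasoning
  defined≤hits : ∀ x → ⟦ is-just (preimage f x) ⟧ ≤ ∑[ u < k ] δ (f u) x
  defined≤hits x with any? (λ u → f u ≟ x)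
  ... | yes (u , fu≡x) = subst (_≤ ∑[ u < k ] δ (f u) x) (cong ⟦_⟧ (dec-true (f u ≟ x) fu≡x))
                                (term≤∑ (λ u → δ (f u) x) u)
  ... | no _           = z≤n
  hits : ∀ y → ∑[ x < n ] δ y x ≡ 1
  hits y = trans (sum-cong-≗ (λ x → sym (*-identityʳ (δ y x)))) (∑-δ y (λ _ → 1))

module _ {k n : ℕ} (H : Graph k) (G : Graph n) (χ : Fin n → Fin k) where

  coloredCopies : List (ContainsCopy H G) → List (ColoredCopy H G χ)
  coloredCopies [] = []
  coloredCopies ((f , inj , hom) ∷ cs) with all? (λ u → χ (f u) ≟ u)
  ... | yes colored = record { emb = f ; inj = inj ; hom = hom ; colored = colored } ∷ coloredCopies cs
  ... | no _        = coloredCopies cs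

  coloredCopies-count : ∀ {{_ : NonZero k}} cs →
    ∑[ a < length cs ] (⟦ extends χ (preimage (proj₁ (lookup cs a))) ⟧ * (weight (preimage (proj₁ (lookup cs a))) * 1))
      ≤ length (coloredCopies cs) * k ^ k
  coloredCopies-count [] = z≤n
  coloredCopies-count ((f , inj , hom) ∷ cs) with all? (λ u → χ (f u) ≟ u)
  ... | yes _ = +-mono-≤ term≤k^k (coloredCopies-count cs)
    where
    term≤k^k : ⟦ extends χ (preimage f) ⟧ * (weight (preimage f) * 1) ≤ k ^ k
    term≤k^k with extends χ (preimage f)
    ... | true  = ≤-trans (≤-reflexive (trans (+-identityʳ _) (*-identityʳ _))) (^-monoʳ-≤ k (size-preimage f))
    ... | false = z≤n
  ... | no uncolored with extends χ (preimage f) in ext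
  ...   | true  = contradiction (λ u → extends⇒agrees χ (preimage f) ext (preimage-image inj u)) uncolored
  ...   | false = coloredCopies-count cs

  coloredCopies-disjoint-from : ∀ f cs → All (λ d → NoCommonEdge H f (proj₁ d)) cs →
                                All (λ d → NoCommonEdge H f (emb d)) (coloredCopies cs)
  coloredCopies-disjoint-from f [] [] = []
  coloredCopies-disjoint-from f ((g , inj , hom) ∷ cs) (fg ∷ fcs) with all? (λ u → χ (g u) ≟ u)
  ... | yes _ = fg ∷ coloredCopies-disjoint-from f cs fcs
  ... | no _  = coloredCopies-disjoint-from f cs fcs

  coloredCopies-disjoint : ∀ cs → AllPairs (EdgeDisjointCopies H G) cs → AllPairs EdgeDisjoint (coloredCopies cs)
  coloredCopies-disjoint [] [] = []
  coloredCopies-disjoint ((f , inj , hom) ∷ cs) (f-cs ∷ disjoint) with all? (λ u → χ (f u) ≟ u)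
  ... | yes _ = coloredCopies-disjoint-from f cs f-cs ∷ coloredCopies-disjoint cs disjoint
  ... | no _  = coloredCopies-disjoint cs disjoint

goodColoring : ∀ {k n} (H : Graph (suc k)) (G : Graph n) cs →
  ∃ λ χ → length cs ≤ length (coloredCopies H G χ cs) * suc k ^ suc k
goodColoring {k} H G cs = χ , (begin
  length cs                                                   ≡⟨ trans (∑-const (length cs) 1) (*-identityʳ _) ⟨
  ∑[ a < length cs ] 1                                        ≤⟨ proj₂ (conditionalExpectation demand (λ _ → 1)) ⟩
  ∑[ a < length cs ] (⟦ extends χ (demand a) ⟧ * (weight (demand a) * 1)) ≤⟨ coloredCopies-count H G χ cs ⟩
  length (coloredCopies H G χ cs) * suc k ^ suc k             ∎)
  where
  open ≤-Reasoning
  demand : Fin (length cs) → PartialColoring _ (suc k)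
  demand a = preimage (proj₁ (lookup cs a))
  χ = proj₁ (conditionalExpectation demand (λ _ → 1))

ℕ→ℚ≡mkℚ : ∀ m → ℕ→ℚ m ≡ mkℚ (ℤ.+ m) 0 (Coprimality.sym (1-coprimeTo m))
ℕ→ℚ≡mkℚ m = ℚ.normalize-coprime (Coprimality.sym (1-coprimeTo m))

ℕ→ℚ-* : ∀ a b → ℕ→ℚ (a * b) ≡ ℕ→ℚ a ℚ.* ℕ→ℚ b
ℕ→ℚ-* a b rewrite ℕ→ℚ≡mkℚ a | ℕ→ℚ≡mkℚ b = cong (ℚ._/ 1) (ℤ.pos-* a b)

ℕ→ℚ-mono : ∀ {a b} → a ≤ b → ℕ→ℚ a ℚ.≤ ℕ→ℚ b
ℕ→ℚ-mono {a} {b} a≤b rewrite ℕ→ℚ≡mkℚ a | ℕ→ℚ≡mkℚ b =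
  ℚ.*≤* (subst₂ ℤ._≤_ (sym (ℤ.*-identityʳ (ℤ.+ a))) (sym (ℤ.*-identityʳ (ℤ.+ b))) (ℤ.+≤+ a≤b))

<ℕ→ℚ⇒≤ℕ→ℚ* : ∀ {q a b c} → q ℚ.< ℕ→ℚ a → a ≤ b * c → q ℚ.≤ ℕ→ℚ b ℚ.* ℕ→ℚ c
<ℕ→ℚ⇒≤ℕ→ℚ* {b = b} {c} q<a a≤bc rewrite sym (ℕ→ℚ-* b c) = ℚ.<⇒≤ (ℚ.<-≤-trans q<a (ℕ→ℚ-mono a≤bc))

lemma5p1 : ∀ {k n : ℕ} (H : Graph k) (G : Graph n) (ε : ℚ) →
    Connected H → 1 ≤ edgeCount H →
    FarFrom ε H G →
    Σ (Fin n → Fin k) λ χ →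
    Σ (List (ColoredCopy H G χ)) λ cs →
    AllPairs EdgeDisjoint cs ×
    (ε ℚ.* ℕ→ℚ n) ℚ.≤ (ℕ→ℚ (length cs) ℚ.* ℕ→ℚ (edgeCount H * (k ^ k)))
lemma5p1 {zero} H G ε _ () far
lemma5p1 {k@(suc _)} {n} H G ε _ 1≤eH far = χ , cs , coloredCopies-disjoint H G χ copies disjoint ,
  <ℕ→ℚ⇒≤ℕ→ℚ* {b = length cs} (far remainder G′⊆G remainder-free) (begin
    edgeCount G ∸ edgeCount remainder  ≤⟨ edgeCount-∸-≤ G remainder H (length copies) arcs ⟩
    length copies * edgeCount H        ≤⟨ *-monoˡ-≤ (edgeCount H) copies≤ ⟩
    length cs * k ^ k * edgeCount H    ≡⟨ trans (*-assoc (length cs) _ _) (cong (length cs *_) (*-comm (k ^ k) _)) ⟩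
    length cs * (edgeCount H * k ^ k)  ∎)
  where
  open ≤-Reasoning
  packed = greedyPacking H G (proj₂ (proj₂ (1≤edgeCount⇒edge H 1≤eH)))
  remainder = proj₁ packed
  remainder-free = proj₂ (proj₂ packed)
  open Packing (proj₁ (proj₂ packed))
  good = goodColoring H G copies
  χ = proj₁ good
  copies≤ = proj₂ good
  cs = coloredCopies H G χ copies
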